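{- Let $n \in \mathbb N$, let $q > 2$ be a power of $2$, let $\zeta$ be a primitive complex $q$th root of unity, let $H \in \mathcal H_n(q)$, and let $A = (J-H)/(1-\zeta)$. Then $\operatorname{tr} (A^k) \in (1-\zeta) \mathbb Z [\zeta]$ for all $k \in \mathbb N$.
   Context: $\mathcal H_n(q)$ is the set of Hermitean $n\times n$ matrices all of whose entries are powers of $\zeta$. $J$ is the all-ones matrix. -}

module Defs where

open import Data.Nat as ℕ using (ℕ; zero; suc)
open import Data.Integer as ℤ using (ℤ; +_; -_)
open import Data.Fin using (Fin; toℕ)
open import Data.Vec using (Vec; []; _∷_; zipWith; replicate; init; last; reverse; map; tabulate)
open import Data.List using (List; []; _∷_)
open import Data.Bool using (if_then_else_)
open import Data.Product using (∃)
open import Relation.Binary.PropositionalEquality using (_≡_)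

-- The cyclotomic ring ℤ[ζ] for ζ a primitive q-th root of unity, q = 2h a
-- power of 2, modelled as ℤ[x]/(x^h + 1) (Φ_q(x) = x^h + 1), elements given
-- by their coefficient vectors (a₀,…,a_{h-1}); ζ corresponds to x.
Cyc : ℕ → Set
Cyc h = Vec ℤ h

module _ {h : ℕ} where

  0c : Cyc h
  0c = replicate h (+ 0)

  1c : Cyc h
  1c = tabulate (λ i → if toℕ i ℕ.≡ᵇ 0 then + 1 else + 0)

  ζ : Cyc h
  ζ = tabulate (λ i → if toℕ i ℕ.≡ᵇ 1 then + 1 else + 0)

  infixl 6 _+c_ _-c_

  _+c_ : Cyc h → Cyc h → Cyc h
  _+c_ = zipWith ℤ._+_

  negc : Cyc h → Cyc h
  negc = map (-_)

  _-c_ : Cyc h → Cyc h → Cyc h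
  a -c b = a +c negc b

  scale : ℤ → Cyc h → Cyc h
  scale c = map (c ℤ.*_)

-- multiplication by x modulo x^h + 1
mulX : {h : ℕ} → Cyc h → Cyc h
mulX {zero} [] = []
mulX {suc n} v = (- last v) ∷ init v

mulL : {h : ℕ} → List ℤ → Cyc h → Cyc h
mulL [] b = 0c
mulL (c ∷ cs) b = scale c b +c mulL cs (mulX b)

toList : {h : ℕ} → Vec ℤ h → List ℤ
toList [] = []
toList (a ∷ as) = a ∷ toList as

infixl 7 _*c_
_*c_ : {h : ℕ} → Cyc h → Cyc h → Cyc h
a *c b = mulL (toList a) b

ζ^ : {h : ℕ} → ℕ → Cyc h
ζ^ zero = 1c
ζ^ (suc k) = mulX (ζ^ k)

-- complex conjugation on ℤ[ζ]: the ring automorphism ζ ↦ ζ⁻¹ = -ζ^(h-1)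
conj : {h : ℕ} → Cyc h → Cyc h
conj [] = []
conj (a ∷ as) = a ∷ reverse (map (-_) as)

Mat : ℕ → ℕ → Set
Mat h n = Fin n → Fin n → Cyc h

sumFin : {h n : ℕ} → (Fin n → Cyc h) → Cyc h
sumFin {n = zero} f = 0c
sumFin {n = suc n} f = f Fin.zero +c sumFin (λ i → f (Fin.suc i))
  where import Data.Fin as Fin

idM : {h n : ℕ} → Mat h n
idM i j = if ⌊ i ≟ j ⌋ then 1c else 0c
  where open import Data.Fin using (_≟_)
        open import Relation.Nullary.Decidable using (⌊_⌋)

_*M_ : {h n : ℕ} → Mat h n → Mat h n → Mat h n
(A *M B) i j = sumFin (λ k → A i k *c B k j)

_^M_ : {h n : ℕ} → Mat h n → ℕ → Mat h n
A ^M zero = idM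
A ^M suc k = A *M (A ^M k)

trace : {h n : ℕ} → Mat h n → Cyc h
trace A = sumFin (λ i → A i i)

EntriesPowersOfζ : {h n : ℕ} → Mat h n → Set
EntriesPowersOfζ H = ∀ i j → ∃ λ k → H i j ≡ ζ^ k

Hermitian : {h n : ℕ} → Mat h n → Set
Hermitian H = ∀ i j → H j i ≡ conj (H i j)

In1-ζ : {h : ℕ} → Cyc h → Set
In1-ζ {h} a = ∃ λ (c : Cyc h) → a ≡ (1c -c ζ) *c c

-- Reduction modulo 1 - ζ is the ring map ℤ[ζ] → 𝔽₂ taking a to the parity of its coefficient
-- sum, and its kernel is exactly (1 - ζ): if the coefficient sum of a is 2t, the partial sums
-- of a shifted by -t are the coefficients of a / (1 - ζ). So it suffices that the reduction M
-- of A has tr (M ^ (k + 1)) = 0 in 𝔽₂.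
--
-- Write ev a and od a for the sums of the even- and odd-indexed coefficients of a, with
-- h = q / 2 even. Multiplication by ζ moves the even-indexed coefficients to odd positions, so
-- od ((1 - ζ) a) = od a - ev a, which has the parity of the coefficient sum of a; and
-- conjugation sends the coefficient at index i to minus the one at index h - i, of the same
-- parity, so od (conj a) = - od a. From (1 - ζ) A = J - H, the entry M i j is therefore the
-- parity of od (H i j), which is symmetric in i, j and zero on the diagonal since H is
-- Hermitian. Finally, over 𝔽₂, tr (M ^ (k + 1)) = Σ i l, M i l (M ^ k) l i is a sum over a
-- symmetric array with zero diagonal, whose off-diagonal terms cancel in pairs.

module Submission where

open import Defs
open import Data.Nat using (ℕ; suc; _^_)
open import Relation.Binary.PropositionalEquality using (_≡_)

open import Algebra.Bundles using (CommutativeSemiring)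
open import Data.Nat using (zero)
open import Data.Fin using (Fin; zero; suc; _≟_)

module SquareMatrix {c ℓ} (R : CommutativeSemiring c ℓ) where

  open CommutativeSemiring R hiding (zero)
  open import Algebra.Properties.Semiring.Sum semiring
  open import Relation.Binary.Reasoning.Setoid setoid

  Matrix : ℕ → Set c
  Matrix n = Fin n → Fin n → Carrier

  private variable n : ℕ

  infix 4 _≈ᴹ_
  infixl 7 _*ᴹ_
  infixr 8 _^ᴹ_

  _≈ᴹ_ : Matrix n → Matrix n → Set ℓ
  M ≈ᴹ N = ∀ i j → M i j ≈ N i j

  1ᴹ : Matrix n
  1ᴹ zero    zero    = 1#
  1ᴹ zero    (suc j) = 0#
  1ᴹ (suc i) zero    = 0#
  1ᴹ (suc i) (suc j) = 1ᴹ i j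

  _*ᴹ_ : Matrix n → Matrix n → Matrix n
  _*ᴹ_ {n} M N i j = ∑[ l < n ] (M i l * N l j)

  _^ᴹ_ : Matrix n → ℕ → Matrix n
  M ^ᴹ zero  = 1ᴹ
  M ^ᴹ suc k = M *ᴹ M ^ᴹ k

  tr : Matrix n → Carrier
  tr {n} M = ∑[ i < n ] M i i

  Symmetric : Matrix n → Set ℓ
  Symmetric M = ∀ i j → M i j ≈ M j i

  *ᴹ-cong : ∀ {M M′ N N′ : Matrix n} → M ≈ᴹ M′ → N ≈ᴹ N′ → M *ᴹ N ≈ᴹ M′ *ᴹ N′
  *ᴹ-cong M≈M′ N≈N′ i j = sum-cong-≋ (λ l → *-cong (M≈M′ i l) (N≈N′ l j))

  *ᴹ-assoc : ∀ (M N P : Matrix n) → (M *ᴹ N) *ᴹ P ≈ᴹ M *ᴹ (N *ᴹ P)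
  *ᴹ-assoc {n} M N P i j = begin
    ∑[ l < n ] (∑[ m < n ] (M i m * N m l) * P l j)
      ≈⟨ sum-cong-≋ (λ l → *-distribʳ-sum {n} (P l j) _) ⟩
    ∑[ l < n ] ∑[ m < n ] (M i m * N m l * P l j)
      ≈⟨ sum-cong-≋ {n} (λ l → sum-cong-≋ {n} (λ m → *-assoc (M i m) (N m l) (P l j))) ⟩
    ∑[ l < n ] ∑[ m < n ] (M i m * (N m l * P l j))
      ≈⟨ ∑-comm {n} {n} _ ⟩
    ∑[ m < n ] ∑[ l < n ] (M i m * (N m l * P l j))
      ≈⟨ sum-cong-≋ (λ m → *-distribˡ-sum {n} (M i m) _) ⟨
    ∑[ m < n ] (M i m * ∑[ l < n ] (N m l * P l j))
      ∎

  1ᴹ-symmetric : Symmetric (1ᴹ {n})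
  1ᴹ-symmetric zero    zero    = refl
  1ᴹ-symmetric zero    (suc j) = refl
  1ᴹ-symmetric (suc i) zero    = refl
  1ᴹ-symmetric (suc i) (suc j) = 1ᴹ-symmetric i j

  ∑-1ᴹˡ : ∀ (g : Fin n → Carrier) i → ∑[ l < n ] (1ᴹ i l * g l) ≈ g i
  ∑-1ᴹˡ {suc n} g zero = begin
    1# * g zero + ∑[ l < n ] (0# * g (suc l))  ≈⟨ +-cong (*-identityˡ _) (sum-cong-≋ {n} (λ l → zeroˡ _)) ⟩
    g zero + ∑[ l < n ] 0#                      ≈⟨ +-congˡ (sum-replicate-zero n) ⟩
    g zero + 0#                                 ≈⟨ +-identityʳ _ ⟩
    g zero                                      ∎
  ∑-1ᴹˡ {suc n} g (suc i) = begin
    0# * g zero + ∑[ l < n ] (1ᴹ i l * g (suc l))  ≈⟨ +-cong (zeroˡ _) (∑-1ᴹˡ (λ l → g (suc l)) i) ⟩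
    0# + g (suc i)                                 ≈⟨ +-identityˡ _ ⟩
    g (suc i)                                      ∎

  ∑-1ᴹʳ : ∀ (g : Fin n → Carrier) j → ∑[ l < n ] (g l * 1ᴹ l j) ≈ g j
  ∑-1ᴹʳ {n} g j =
    trans (sum-cong-≋ {n} (λ l → trans (*-comm _ _) (*-cong (1ᴹ-symmetric l j) refl))) (∑-1ᴹˡ g j)

  *ᴹ-identityˡ : ∀ (M : Matrix n) → 1ᴹ *ᴹ M ≈ᴹ M
  *ᴹ-identityˡ M i j = ∑-1ᴹˡ (λ l → M l j) i

  *ᴹ-identityʳ : ∀ (M : Matrix n) → M *ᴹ 1ᴹ ≈ᴹ M
  *ᴹ-identityʳ M i j = ∑-1ᴹʳ (M i) j

  ^ᴹ-comm : ∀ (M : Matrix n) k → M *ᴹ M ^ᴹ k ≈ᴹ M ^ᴹ k *ᴹ M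
  ^ᴹ-comm M zero i j = trans (*ᴹ-identityʳ M i j) (sym (*ᴹ-identityˡ M i j))
  ^ᴹ-comm M (suc k) i j = begin
    (M *ᴹ (M *ᴹ M ^ᴹ k)) i j   ≈⟨ *ᴹ-cong {M = M} (λ _ _ → refl) (^ᴹ-comm M k) i j ⟩
    (M *ᴹ (M ^ᴹ k *ᴹ M)) i j   ≈⟨ *ᴹ-assoc M (M ^ᴹ k) M i j ⟨
    (M *ᴹ M ^ᴹ k *ᴹ M) i j     ∎

  *ᴹ-transpose : ∀ {M N : Matrix n} → Symmetric M → Symmetric N → ∀ i j → (M *ᴹ N) i j ≈ (N *ᴹ M) j i
  *ᴹ-transpose M-sym N-sym i j = sum-cong-≋ (λ l → trans (*-cong (M-sym i l) (N-sym l j)) (*-comm _ _))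

  ^ᴹ-symmetric : ∀ {M : Matrix n} → Symmetric M → ∀ k → Symmetric (M ^ᴹ k)
  ^ᴹ-symmetric M-sym zero = 1ᴹ-symmetric
  ^ᴹ-symmetric {M = M} M-sym (suc k) i j =
    trans (*ᴹ-transpose M-sym (^ᴹ-symmetric M-sym k) i j) (sym (^ᴹ-comm M k j i))

  ∑∑-symmetric-zero-diagonal : (∀ x → x + x ≈ 0#) → ∀ {n} (f : Fin n → Fin n → Carrier) →
    (∀ i j → f i j ≈ f j i) → (∀ i → f i i ≈ 0#) → ∑[ i < n ] ∑[ j < n ] f i j ≈ 0#
  ∑∑-symmetric-zero-diagonal x+x≈0 {zero} f f-sym f-diag = refl
  ∑∑-symmetric-zero-diagonal x+x≈0 {suc n} f f-sym f-diag = begin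
    (f zero zero + ∑ʳ) + ∑[ i < n ] (f (suc i) zero + ∑[ j < n ] f (suc i) (suc j))
      ≈⟨ +-cong (+-cong (f-diag zero) refl) (∑-distrib-+ {n} _ _) ⟩
    (0# + ∑ʳ) + (∑[ i < n ] f (suc i) zero + ∑[ i < n ] ∑[ j < n ] f (suc i) (suc j))
      ≈⟨ +-cong (+-identityˡ _) (+-cong (sum-cong-≋ {n} (λ i → f-sym (suc i) zero))
           (∑∑-symmetric-zero-diagonal x+x≈0 _ (λ i j → f-sym (suc i) (suc j)) (λ i → f-diag (suc i)))) ⟩
    ∑ʳ + (∑ʳ + 0#)  ≈⟨ +-congˡ (+-identityʳ _) ⟩
    ∑ʳ + ∑ʳ         ≈⟨ x+x≈0 _ ⟩
    0#              ∎
    where ∑ʳ = ∑[ j < n ] f zero (suc j)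

  tr-^ᴹ-suc : (∀ x → x + x ≈ 0#) → ∀ {M : Matrix n} → Symmetric M → (∀ i → M i i ≈ 0#) →
    ∀ k → tr (M ^ᴹ suc k) ≈ 0#
  tr-^ᴹ-suc x+x≈0 {M = M} M-sym M-diag k = ∑∑-symmetric-zero-diagonal x+x≈0 _
    (λ i l → *-cong (M-sym i l) (^ᴹ-symmetric M-sym k l i))
    (λ i → trans (*-cong (M-diag i) refl) (zeroˡ _))


open import Data.Nat as ℕ using (parity)
import Data.Nat.Properties as ℕ
open import Data.Integer as ℤ using (ℤ; +_; -[1+_]; -_; _+_; _*_; _-_; ∣_∣; _⊖_)
import Data.Integer.Properties as ℤ
open import Data.Integer.Tactic.RingSolver using (solve-∀)
open import Data.Parity.Base as ℙ using (Parity; 0ℙ; 1ℙ)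
import Data.Parity.Properties as ℙ
open import Data.Vec using (Vec; []; _∷_; _∷ʳ_; init; last; reverse; replicate; tabulate; map; zipWith)
import Data.Vec.Properties as Vecₚ
open import Data.Product using (∃-syntax; _×_; _,_)
open import Function using (_∘_)
open import Relation.Nullary using (yes; no)
open import Algebra.Properties.CommutativeSemigroup ℤ.+-commutativeSemigroup using (interchange)
open import Relation.Binary.PropositionalEquality using (refl; sym; trans; cong; cong₂; subst; module ≡-Reasoning)
open import Algebra.Properties.Semiring.Sum ℙ.+-*-semiring using (sum; sum-cong-≗)
open SquareMatrix ℙ.+-*-commutativeSemiring

private variable h m n : ℕ

parityℤ : ℤ → Parity
parityℤ i = parity ∣ i ∣

parityℤ-neg : ∀ i → parityℤ (- i) ≡ parityℤ i
parityℤ-neg i = cong parity (ℤ.∣-i∣≡∣i∣ i)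

parityℤ-homo-* : ∀ i j → parityℤ (i * j) ≡ parityℤ i ℙ.* parityℤ j
parityℤ-homo-* i j = trans (cong parity (ℤ.abs-* i j)) (ℙ.*-homo-* ∣ i ∣ ∣ j ∣)

parity-+-suc : ∀ m n → parity (m ℕ.+ n) ≡ parity (suc m) ℙ.+ parity (suc n)
parity-+-suc m n = trans (cong (parity ∘ suc) (sym (ℕ.+-suc m n))) (ℙ.+-homo-+ (suc m) (suc n))

parity-⊖ : ∀ m n → parityℤ (m ⊖ n) ≡ parity m ℙ.+ parity n
parity-⊖ zero    zero    = refl
parity-⊖ zero    (suc n) = refl
parity-⊖ (suc m) zero    = sym (ℙ.+-identityʳ _)
parity-⊖ (suc m) (suc n) = begin
  parityℤ (suc m ⊖ suc n)            ≡⟨ cong parityℤ (ℤ.[1+m]⊖[1+n]≡m⊖n m n) ⟩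
  parityℤ (m ⊖ n)                    ≡⟨ parity-⊖ m n ⟩
  parity m ℙ.+ parity n              ≡⟨ ℙ.+-homo-+ m n ⟨
  parity (m ℕ.+ n)                   ≡⟨ parity-+-suc m n ⟩
  parity (suc m) ℙ.+ parity (suc n)  ∎
  where open ≡-Reasoning

parityℤ-homo-+ : ∀ i j → parityℤ (i + j) ≡ parityℤ i ℙ.+ parityℤ j
parityℤ-homo-+ (+ m)    (+ n)    = ℙ.+-homo-+ m n
parityℤ-homo-+ (+ m)    -[1+ n ] = parity-⊖ m (suc n)
parityℤ-homo-+ -[1+ m ] (+ n)    = trans (parity-⊖ n (suc m)) (ℙ.+-comm (parity n) (parity (suc m)))
parityℤ-homo-+ -[1+ m ] -[1+ n ] = parity-+-suc m n

parity≡0ℙ⇒double : ∀ n → parity n ≡ 0ℙ → ∃[ k ] n ≡ k ℕ.+ k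
parity≡0ℙ⇒double zero          _ = 0 , refl
parity≡0ℙ⇒double (suc zero)    ()
parity≡0ℙ⇒double (suc (suc n)) p with parity≡0ℙ⇒double n p
... | k , refl = suc k , cong suc (sym (ℕ.+-suc k k))

parityℤ≡0ℙ⇒double : ∀ i → parityℤ i ≡ 0ℙ → ∃[ t ] i ≡ t + t
parityℤ≡0ℙ⇒double (+ n) p with parity≡0ℙ⇒double n p
... | k , refl = + k , refl
parityℤ≡0ℙ⇒double -[1+ n ] p with parity≡0ℙ⇒double (suc n) p
... | k , 1+n≡k+k = - + k , trans (cong (-_ ∘ +_) 1+n≡k+k) (ℤ.neg-distrib-+ (+ k) (+ k))

i≡-i⇒i≡0 : ∀ i → i ≡ - i → i ≡ + 0
i≡-i⇒i≡0 (+ zero)  _ = refl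
i≡-i⇒i≡0 (+ suc n) ()
i≡-i⇒i≡0 -[1+ n ]  ()

tabulate-const : ∀ {A : Set} (x : A) → tabulate {n = n} (λ _ → x) ≡ replicate n x
tabulate-const {zero}  x = refl
tabulate-const {suc n} x = cong (x ∷_) (tabulate-const x)

coeffSum : Vec ℤ h → ℤ
coeffSum []       = + 0
coeffSum (a ∷ as) = a + coeffSum as

evenSum oddSum : Vec ℤ h → ℤ
evenSum []       = + 0
evenSum (a ∷ as) = a + oddSum as
oddSum []       = + 0
oddSum (a ∷ as) = evenSum as

coeffSum≡evenSum+oddSum : (a : Vec ℤ h) → coeffSum a ≡ evenSum a + oddSum a
coeffSum≡evenSum+oddSum []      = refl
coeffSum≡evenSum+oddSum (x ∷ a) =
  trans (cong (_+_ x) (trans (coeffSum≡evenSum+oddSum a) (ℤ.+-comm (evenSum a) (oddSum a))))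
        (sym (ℤ.+-assoc x (oddSum a) (evenSum a)))

coeffSum-+c : (a b : Cyc h) → coeffSum (a +c b) ≡ coeffSum a + coeffSum b
coeffSum-+c []      []      = refl
coeffSum-+c (x ∷ a) (y ∷ b) = trans (cong (_+_ (x + y)) (coeffSum-+c a b)) (interchange x y _ _)

evenSum-+c : (a b : Cyc h) → evenSum (a +c b) ≡ evenSum a + evenSum b
oddSum-+c  : (a b : Cyc h) → oddSum (a +c b) ≡ oddSum a + oddSum b
evenSum-+c []      []      = refl
evenSum-+c (x ∷ a) (y ∷ b) = trans (cong (_+_ (x + y)) (oddSum-+c a b)) (interchange x y _ _)
oddSum-+c []      []      = refl
oddSum-+c (x ∷ a) (y ∷ b) = evenSum-+c a b

coeffSum-scale : ∀ c (a : Cyc h) → coeffSum (scale c a) ≡ c * coeffSum a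
coeffSum-scale c []      = sym (ℤ.*-zeroʳ c)
coeffSum-scale c (x ∷ a) = trans (cong (_+_ (c * x)) (coeffSum-scale c a)) (sym (ℤ.*-distribˡ-+ c x _))

coeffSum-0c : coeffSum (0c {h}) ≡ + 0
coeffSum-0c {zero}  = refl
coeffSum-0c {suc h} = trans (ℤ.+-identityˡ _) (coeffSum-0c {h})

evenSum-0c : evenSum (0c {h}) ≡ + 0
oddSum-0c  : oddSum (0c {h}) ≡ + 0
evenSum-0c {zero}  = refl
evenSum-0c {suc h} = trans (ℤ.+-identityˡ _) (oddSum-0c {h})
oddSum-0c {zero}  = refl
oddSum-0c {suc h} = evenSum-0c {h}

coeffSum-init-last : (a : Vec ℤ (suc h)) → coeffSum a ≡ coeffSum (init a) + last a
coeffSum-init-last (x ∷ [])    = ℤ.+-comm x (+ 0)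
coeffSum-init-last (x ∷ y ∷ a) =
  trans (cong (_+_ x) (coeffSum-init-last (y ∷ a))) (sym (ℤ.+-assoc x _ _))

evenSum-negc : (a : Cyc h) → evenSum (negc a) ≡ - evenSum a
oddSum-negc  : (a : Cyc h) → oddSum (negc a) ≡ - oddSum a
evenSum-negc []      = refl
evenSum-negc (x ∷ a) = trans (cong (_+_ (- x)) (oddSum-negc a)) (sym (ℤ.neg-distrib-+ x _))
oddSum-negc []      = refl
oddSum-negc (x ∷ a) = evenSum-negc a

oddSum--c : (a b : Cyc h) → oddSum (a -c b) ≡ oddSum a - oddSum b
oddSum--c a b = trans (oddSum-+c a (negc b)) (cong (_+_ (oddSum a)) (oddSum-negc b))

residue : Cyc h → Parity
residue a = parityℤ (coeffSum a)

residue-+c : (a b : Cyc h) → residue (a +c b) ≡ residue a ℙ.+ residue b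
residue-+c a b = trans (cong parityℤ (coeffSum-+c a b)) (parityℤ-homo-+ (coeffSum a) (coeffSum b))

residue-scale : ∀ c (a : Cyc h) → residue (scale c a) ≡ parityℤ c ℙ.* residue a
residue-scale c a = trans (cong parityℤ (coeffSum-scale c a)) (parityℤ-homo-* c _)

residue-0c : residue (0c {h}) ≡ 0ℙ
residue-0c {h} = cong parityℤ (coeffSum-0c {h})

residue-1c : residue (1c {suc h}) ≡ 1ℙ
residue-1c {h} = cong (parityℤ ∘ _+_ (+ 1)) (trans (cong coeffSum (tabulate-const {h} (+ 0))) (coeffSum-0c {h}))

residue-mulX : (a : Cyc h) → residue (mulX a) ≡ residue a
residue-mulX {zero}  [] = refl
residue-mulX {suc _} a  = begin
  parityℤ (- last a + ∑init)             ≡⟨ parityℤ-homo-+ (- last a) ∑init ⟩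
  parityℤ (- last a) ℙ.+ parityℤ ∑init   ≡⟨ cong (ℙ._+ parityℤ ∑init) (parityℤ-neg (last a)) ⟩
  parityℤ (last a) ℙ.+ parityℤ ∑init     ≡⟨ ℙ.+-comm (parityℤ (last a)) (parityℤ ∑init) ⟩
  parityℤ ∑init ℙ.+ parityℤ (last a)     ≡⟨ parityℤ-homo-+ ∑init (last a) ⟨
  parityℤ (∑init + last a)               ≡⟨ cong parityℤ (coeffSum-init-last a) ⟨
  residue a                              ∎
  where
  open ≡-Reasoning
  ∑init = coeffSum (init a)

residue-mulL : ∀ {m} (a : Vec ℤ m) (b : Cyc h) → residue (mulL (toList a) b) ≡ residue a ℙ.* residue b
residue-mulL {h} []      b = residue-0c {h}
residue-mulL (x ∷ a) b = begin
  residue (scale x b +c mulL (toList a) (mulX b))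
    ≡⟨ residue-+c (scale x b) _ ⟩
  residue (scale x b) ℙ.+ residue (mulL (toList a) (mulX b))
    ≡⟨ cong₂ ℙ._+_ (residue-scale x b) (residue-mulL a (mulX b)) ⟩
  (parityℤ x ℙ.* residue b) ℙ.+ (residue a ℙ.* residue (mulX b))
    ≡⟨ cong (λ r → (parityℤ x ℙ.* residue b) ℙ.+ (residue a ℙ.* r)) (residue-mulX b) ⟩
  (parityℤ x ℙ.* residue b) ℙ.+ (residue a ℙ.* residue b)
    ≡⟨ ℙ.*-distribʳ-+ (residue b) (parityℤ x) (residue a) ⟨
  (parityℤ x ℙ.+ residue a) ℙ.* residue b
    ≡⟨ cong (ℙ._* residue b) (parityℤ-homo-+ x (coeffSum a)) ⟨
  residue (x ∷ a) ℙ.* residue b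
    ∎
  where open ≡-Reasoning

residue-*c : (a b : Cyc h) → residue (a *c b) ≡ residue a ℙ.* residue b
residue-*c = residue-mulL

residue-sumFin : (f : Fin n → Cyc h) → residue (sumFin f) ≡ sum (residue ∘ f)
residue-sumFin {zero}  {h} f = residue-0c {h}
residue-sumFin {suc n}     f = trans (residue-+c (f zero) _) (cong (residue (f zero) ℙ.+_) (residue-sumFin (f ∘ suc)))

idM-suc : (i j : Fin n) → idM {h} (suc i) (suc j) ≡ idM i j
idM-suc i j with i ≟ j
... | yes _ = refl
... | no _  = refl

residue-idM : (i j : Fin n) → residue (idM {suc h} i j) ≡ 1ᴹ i j
residue-idM {h = h} zero    zero    = residue-1c {h}
residue-idM {h = h} zero    (suc j) = residue-0c {suc h}
residue-idM {h = h} (suc i) zero    = residue-0c {suc h}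
residue-idM         (suc i) (suc j) = trans (cong residue (idM-suc i j)) (residue-idM i j)

residueᴹ : Mat h n → Matrix n
residueᴹ A i j = residue (A i j)

residue-^M : (A : Mat (suc h) n) (k : ℕ) → ∀ i j → residue ((A ^M k) i j) ≡ (residueᴹ A ^ᴹ k) i j
residue-^M A zero    i j = residue-idM i j
residue-^M {n = n} A (suc k) i j =
  trans (residue-sumFin (λ l → A i l *c (A ^M k) l j)) (sum-cong-≗ {n} λ l →
    trans (residue-*c (A i l) ((A ^M k) l j)) (cong (residue (A i l) ℙ.*_) (residue-^M A k l j)))

+c-identityʳ : (a : Cyc h) → a +c 0c ≡ a
+c-identityʳ a =
  trans (Vecₚ.zipWith-replicate₂ _+_ a (+ 0)) (trans (Vecₚ.map-cong ℤ.+-identityʳ a) (Vecₚ.map-id a))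

scale-identity : (a : Cyc h) → scale (+ 1) a ≡ a
scale-identity a = trans (Vecₚ.map-cong ℤ.*-identityˡ a) (Vecₚ.map-id a)

scale-[-1]≡negc : (a : Cyc h) → scale -[1+ 0 ] a ≡ negc a
scale-[-1]≡negc a = Vecₚ.map-cong ℤ.-1*i≡-i a

mulL-zeros : ∀ m (b : Cyc h) → mulL (toList (replicate m (+ 0))) b ≡ 0c
mulL-zeros zero    b = refl
mulL-zeros (suc m) b = begin
  scale (+ 0) b +c mulL (toList (replicate m (+ 0))) (mulX b)
    ≡⟨ cong₂ _+c_ (Vecₚ.map-const b (+ 0)) (mulL-zeros m (mulX b)) ⟩
  0c +c 0c
    ≡⟨ Vecₚ.zipWith-replicate _+_ (+ 0) (+ 0) ⟩
  0c
    ∎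
  where open ≡-Reasoning

1c-ζ≡ : 1c -c ζ ≡ + 1 ∷ -[1+ 0 ] ∷ replicate m (+ 0)
1c-ζ≡ {m} = cong (λ zs → + 1 ∷ -[1+ 0 ] ∷ zs) (begin
  zipWith _+_ (tabulate (λ _ → + 0)) (map -_ (tabulate (λ _ → + 0)))
    ≡⟨ cong₂ (λ xs ys → zipWith _+_ xs (map -_ ys)) (tabulate-const (+ 0)) (tabulate-const (+ 0)) ⟩
  zipWith _+_ (replicate m (+ 0)) (map -_ (replicate m (+ 0)))
    ≡⟨ cong (zipWith _+_ (replicate m (+ 0))) (Vecₚ.map-replicate -_ (+ 0) m) ⟩
  zipWith _+_ (replicate m (+ 0)) (replicate m (+ 0))
    ≡⟨ Vecₚ.zipWith-replicate _+_ (+ 0) (+ 0) ⟩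
  replicate m (+ 0)  ∎)
  where open ≡-Reasoning

[1-ζ]*c≡-c-mulX : (c : Cyc (suc (suc m))) → (1c -c ζ) *c c ≡ c -c mulX c
[1-ζ]*c≡-c-mulX {m} c = begin
  (1c -c ζ) *c c
    ≡⟨ cong (_*c c) (1c-ζ≡ {m}) ⟩
  scale (+ 1) c +c (scale -[1+ 0 ] (mulX c) +c mulL (toList (replicate m (+ 0))) (mulX (mulX c)))
    ≡⟨ cong₂ _+c_ (scale-identity c) (cong₂ _+c_ (scale-[-1]≡negc (mulX c)) (mulL-zeros m (mulX (mulX c)))) ⟩
  c +c (negc (mulX c) +c 0c)
    ≡⟨ cong (c +c_) (+c-identityʳ (negc (mulX c))) ⟩
  c -c mulX c  ∎
  where open ≡-Reasoning

y+x-y≡x : ∀ y x → y + x - y ≡ x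
y+x-y≡x = solve-∀

-t+[t+t]≡t : ∀ t → - t + (t + t) ≡ t
-t+[t+t]≡t = solve-∀

partialSums : ℤ → Vec ℤ h → Vec ℤ h
partialSums y []       = []
partialSums y (a ∷ as) = (y + a) ∷ partialSums (y + a) as

last-partialSums : ∀ y (a : Vec ℤ (suc h)) → last (partialSums y a) ≡ y + coeffSum a
last-partialSums y (x ∷ [])    = cong (_+_ y) (sym (ℤ.+-identityʳ x))
last-partialSums y (x ∷ z ∷ a) = trans (last-partialSums (y + x) (z ∷ a)) (ℤ.+-assoc y x _)

partialSums-differences : ∀ y (a : Vec ℤ (suc h)) → partialSums y a -c (y ∷ init (partialSums y a)) ≡ a
partialSums-differences y (x ∷ [])    = cong (_∷ []) (y+x-y≡x y x)
partialSums-differences y (x ∷ z ∷ a) = cong₂ _∷_ (y+x-y≡x y x) (partialSums-differences (y + x) (z ∷ a))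

residue≡0ℙ⇒In1-ζ : (a : Cyc (suc (suc m))) → residue a ≡ 0ℙ → In1-ζ a
residue≡0ℙ⇒In1-ζ a a-even with parityℤ≡0ℙ⇒double (coeffSum a) a-even
... | t , ∑a≡t+t = c , sym (begin
  (1c -c ζ) *c c          ≡⟨ [1-ζ]*c≡-c-mulX c ⟩
  c -c (- last c ∷ init c) ≡⟨ cong (λ y → c -c (y ∷ init c)) -last-c≡-t ⟩
  c -c (- t ∷ init c)     ≡⟨ partialSums-differences (- t) a ⟩
  a                       ∎)
  where
  open ≡-Reasoning
  c = partialSums (- t) a
  -last-c≡-t : - last c ≡ - t
  -last-c≡-t = cong -_ (begin
    last c               ≡⟨ last-partialSums (- t) a ⟩
    - t + coeffSum a     ≡⟨ cong (_+_ (- t)) ∑a≡t+t ⟩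
    - t + (t + t)        ≡⟨ -t+[t+t]≡t t ⟩
    t                    ∎)

data Even : ℕ → Set where
  even-zero : Even zero
  even-2+   : Even n → Even (suc (suc n))

evenSum-init : Even m → (a : Vec ℤ (suc (suc m))) → evenSum (init a) ≡ evenSum a
evenSum-init even-zero    (x ∷ y ∷ [])    = refl
evenSum-init (even-2+ me) (x ∷ y ∷ z ∷ a) = cong (_+_ x) (evenSum-init me (z ∷ a))

oddSum-mulX : Even m → (a : Cyc (suc (suc m))) → oddSum (mulX a) ≡ evenSum a
oddSum-mulX = evenSum-init

oddSum-∷ʳ : Even n → (xs : Vec ℤ n) (x : ℤ) → oddSum (xs ∷ʳ x) ≡ oddSum xs
oddSum-∷ʳ even-zero    []           x = refl
oddSum-∷ʳ (even-2+ ne) (a ∷ b ∷ xs) x = cong (_+_ b) (oddSum-∷ʳ ne xs x)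

evenSum-∷ʳ-even : Even n → (xs : Vec ℤ n) (x : ℤ) → evenSum (xs ∷ʳ x) ≡ evenSum xs + x
evenSum-∷ʳ-even even-zero    []           x = ℤ.+-comm x (+ 0)
evenSum-∷ʳ-even (even-2+ ne) (a ∷ b ∷ xs) x =
  trans (cong (_+_ a) (evenSum-∷ʳ-even ne xs x)) (sym (ℤ.+-assoc a _ x))

evenSum-∷ʳ-odd : Even n → (xs : Vec ℤ (suc n)) (x : ℤ) → evenSum (xs ∷ʳ x) ≡ evenSum xs
evenSum-∷ʳ-odd ne (a ∷ xs) x = cong (_+_ a) (oddSum-∷ʳ ne xs x)

evenSum-reverse : Even n → (xs : Vec ℤ (suc n)) → evenSum (reverse xs) ≡ evenSum xs
evenSum-reverse even-zero    (a ∷ [])     = refl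
evenSum-reverse (even-2+ ne) (a ∷ b ∷ xs) = begin
  evenSum (reverse (a ∷ b ∷ xs))
    ≡⟨ cong evenSum (trans (Vecₚ.reverse-∷ a (b ∷ xs)) (cong (_∷ʳ a) (Vecₚ.reverse-∷ b xs))) ⟩
  evenSum ((reverse xs ∷ʳ b) ∷ʳ a)
    ≡⟨ evenSum-∷ʳ-even (even-2+ ne) (reverse xs ∷ʳ b) a ⟩
  evenSum (reverse xs ∷ʳ b) + a
    ≡⟨ cong (_+ a) (trans (evenSum-∷ʳ-odd ne (reverse xs) b) (evenSum-reverse ne xs)) ⟩
  evenSum xs + a
    ≡⟨ ℤ.+-comm (evenSum xs) a ⟩
  evenSum (a ∷ b ∷ xs)
    ∎
  where open ≡-Reasoning

oddSum-conj : Even m → (a : Cyc (suc (suc m))) → oddSum (conj a) ≡ - oddSum a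
oddSum-conj me (x ∷ a) = trans (evenSum-reverse me (negc a)) (evenSum-negc a)

oddSum-1c : oddSum (1c {suc h}) ≡ + 0
oddSum-1c {h} = trans (cong evenSum (tabulate-const {h} (+ 0))) (evenSum-0c {h})

oddSum-[1-ζ]*c : Even m → (a : Cyc (suc (suc m))) → oddSum ((1c -c ζ) *c a) ≡ oddSum a - evenSum a
oddSum-[1-ζ]*c me a = begin
  oddSum ((1c -c ζ) *c a)     ≡⟨ cong oddSum ([1-ζ]*c≡-c-mulX a) ⟩
  oddSum (a -c mulX a)        ≡⟨ oddSum--c a (mulX a) ⟩
  oddSum a - oddSum (mulX a)  ≡⟨ cong (λ z → oddSum a - z) (oddSum-mulX me a) ⟩
  oddSum a - evenSum a        ∎
  where open ≡-Reasoning

residue≡parity-oddSum-[1-ζ]*c : Even m → (a : Cyc (suc (suc m))) →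
  residue a ≡ parityℤ (oddSum ((1c -c ζ) *c a))
residue≡parity-oddSum-[1-ζ]*c me a = begin
  parityℤ (coeffSum a)                          ≡⟨ cong parityℤ (coeffSum≡evenSum+oddSum a) ⟩
  parityℤ (evenSum a + oddSum a)                ≡⟨ parityℤ-homo-+ (evenSum a) (oddSum a) ⟩
  parityℤ (evenSum a) ℙ.+ parityℤ (oddSum a)    ≡⟨ ℙ.+-comm (parityℤ (evenSum a)) _ ⟩
  parityℤ (oddSum a) ℙ.+ parityℤ (evenSum a)    ≡⟨ cong (parityℤ (oddSum a) ℙ.+_) (parityℤ-neg (evenSum a)) ⟨
  parityℤ (oddSum a) ℙ.+ parityℤ (- evenSum a)  ≡⟨ parityℤ-homo-+ (oddSum a) (- evenSum a) ⟨
  parityℤ (oddSum a - evenSum a)                ≡⟨ cong parityℤ (oddSum-[1-ζ]*c me a) ⟨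
  parityℤ (oddSum ((1c -c ζ) *c a))             ∎
  where open ≡-Reasoning

residue≡parity-oddSum : Even m → {a b : Cyc (suc (suc m))} →
  (1c -c ζ) *c a ≡ 1c -c b → residue a ≡ parityℤ (oddSum b)
residue≡parity-oddSum {m} me {a} {b} [1-ζ]a≡1-b = begin
  residue a                               ≡⟨ residue≡parity-oddSum-[1-ζ]*c me a ⟩
  parityℤ (oddSum ((1c -c ζ) *c a))       ≡⟨ cong (parityℤ ∘ oddSum) [1-ζ]a≡1-b ⟩
  parityℤ (oddSum (1c -c b))              ≡⟨ cong parityℤ (oddSum--c 1c b) ⟩
  parityℤ (oddSum (1c {suc (suc m)}) - oddSum b)
                                          ≡⟨ cong (λ z → parityℤ (z - oddSum b)) (oddSum-1c {suc m}) ⟩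
  parityℤ (+ 0 - oddSum b)                ≡⟨ cong parityℤ (ℤ.+-identityˡ (- oddSum b)) ⟩
  parityℤ (- oddSum b)                    ≡⟨ parityℤ-neg (oddSum b) ⟩
  parityℤ (oddSum b)                      ∎
  where open ≡-Reasoning

trace-^M-suc-∈⟨1-ζ⟩ : Even m → (H A : Mat (suc (suc m)) n) → Hermitian H →
  (∀ i j → (1c -c ζ) *c A i j ≡ 1c -c H i j) → ∀ k → In1-ζ (trace (A ^M suc k))
trace-^M-suc-∈⟨1-ζ⟩ {n = n} me H A H-hermitian A-def k = residue≡0ℙ⇒In1-ζ (trace (A ^M suc k)) (begin
  residue (trace (A ^M suc k))  ≡⟨ residue-sumFin (λ i → (A ^M suc k) i i) ⟩
  tr (residueᴹ (A ^M suc k))    ≡⟨ sum-cong-≗ {n} (λ i → residue-^M A (suc k) i i) ⟩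
  tr (residueᴹ A ^ᴹ suc k)      ≡⟨ tr-^ᴹ-suc ℙ.p+p≡0ℙ residueᴹA-symmetric residueᴹA-zero-diagonal k ⟩
  0ℙ                            ∎)
  where
  open ≡-Reasoning

  residue-A : ∀ i j → residue (A i j) ≡ parityℤ (oddSum (H i j))
  residue-A i j = residue≡parity-oddSum me (A-def i j)

  oddSum-H-antisymmetric : ∀ i j → oddSum (H j i) ≡ - oddSum (H i j)
  oddSum-H-antisymmetric i j = trans (cong oddSum (H-hermitian i j)) (oddSum-conj me (H i j))

  residueᴹA-symmetric : Symmetric (residueᴹ A)
  residueᴹA-symmetric i j = begin
    residue (A i j)             ≡⟨ residue-A i j ⟩
    parityℤ (oddSum (H i j))    ≡⟨ parityℤ-neg (oddSum (H i j)) ⟨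
    parityℤ (- oddSum (H i j))  ≡⟨ cong parityℤ (oddSum-H-antisymmetric i j) ⟨
    parityℤ (oddSum (H j i))    ≡⟨ residue-A j i ⟨
    residue (A j i)             ∎

  residueᴹA-zero-diagonal : ∀ i → residueᴹ A i i ≡ 0ℙ
  residueᴹA-zero-diagonal i =
    trans (residue-A i i) (cong parityℤ (i≡-i⇒i≡0 (oddSum (H i i)) (oddSum-H-antisymmetric i i)))

even-2* : ∀ p → Even (2 ℕ.* p)
even-2* zero    = even-zero
even-2* (suc p) = subst Even (sym (ℕ.*-suc 2 p)) (even-2+ (even-2* p))

2^suc≡2+even : ∀ e → ∃[ m ] Even m × 2 ^ suc e ≡ suc (suc m)
2^suc≡2+even e = 2 ℕ.* p , even-2* p , trans (cong (2 ℕ.*_) 2^e≡1+p) (ℕ.*-suc 2 p)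
  where
  p = ℕ.pred (2 ^ e)
  2^e≡1+p : 2 ^ e ≡ suc p
  2^e≡1+p = sym (ℕ.suc-pred (2 ^ e) {{ℕ.m^n≢0 2 e}})

lemma3p15 : (e n : ℕ) → (H : Mat (2 ^ suc e) n) → EntriesPowersOfζ H → Hermitian H
    → (A : Mat (2 ^ suc e) n) → (∀ i j → (1c -c ζ) *c A i j ≡ 1c -c H i j)
    → (k : ℕ) → In1-ζ (trace (A ^M suc k))
lemma3p15 e n with 2 ^ suc e | 2^suc≡2+even e
... | .(suc (suc m)) | m , m-even , refl = λ H _ H-hermitian A A-def →
  trace-^M-suc-∈⟨1-ζ⟩ m-even H A H-hermitian A-def
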